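{- Let $IP$ be a mixed-integer linear program with $m$ constraints and $\mathtt{cert}$ a VIPR certificate with constraints $C_1,\dots,C_d$, with notation as in the context. If $m+1\le k\le d$, $\mathtt{reason}(C_k)=\mathtt{lin}$, and all previous derived constraints $C_{m+1},\dots,C_{k-1}$ are valid, then $C_k$ is valid if and only if $\phi_{DER}(k)=\mathtt{true}$, where $\phi_{DER}(k)=\phi_{ASM}(k)\wedge\phi_{PRV}(k)\wedge\phi_{DOM}(A,B,eq,geq,leq,(a_{k,j})_{j\in[n]},b_k,s(C_k)=0,s(C_k)\ge0,s(C_k)\le0)$.
   Context: $IP$ has variables $x\in\mathbb{R}^n$, integer index set $I$, objective $c$, sense $\mathtt{min}$ or $\mathtt{max}$, and constraints $C_1,\dots,C_m$. A constraint $C_i$ has coefficients $a_{i,j}$, rhs $b_i$, sign $s(C_i)\in\{ -1,0,1\}$ ($\le,=,\ge$). A VIPR certificate contains $RTP$, a finite $SOL\subseteq\mathbb{R}^n$, and derived constraints $C_{m+1},\dots,C_d$, each with reason in $\{\mathtt{asm},\mathtt{lin},\mathtt{rnd},\mathtt{uns},\mathtt{sol}\}$, data, and assumption set $\mathtt{A}(C_k)\subseteq S=\{i\in\{m+1,\dots,d\}:\mathtt{reason}(C_i)=\mathtt{asm}\}$; $\mathtt{A}(C_i)=\emptyset$ for $i\le m$. For $\mathtt{lin}/\mathtt{rnd}$, data is $\lambda=\mathtt{data}(C_k)\in\mathbb{R}^d$ with support $\mathtt{nz}(\mathtt{data}(C_k))$; for $\mathtt{uns}$, data is $(i_1,l_1,i_2,l_2)\in[d]^4$.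 Domination: $(a,b,s)$ is an absurdity if $a=0$ and ($s=0,b\ne0$) or ($s=1,b>0$) or ($s=-1,b<0$); it dominates $(a',b',s')$ if absurd, or $a=a'$ and [$s'=0\Rightarrow s=0,b=b'$], [$s'=1\Rightarrow s\in\{0,1\},b\ge b'$], [$s'=-1\Rightarrow s\in\{0,-1\},b\le b'$]. The combination $\sum_{i\in N}\lambda_iC_i$ ($N$ = support) has coefficients $\sum\lambda_ia_i$, rhs $\sum\lambda_ib_i$, sign $0$ if all $\lambda_is(C_i)=0$, else $1$ if all $\ge0$, else $-1$ if all $\le0$, else undefined (then it dominates nothing). Roundable: sign $\pm1$, integer coefficients on $I$, zero off $I$; rounding replaces $b$ by $\lceil b\rceil$ or $\lfloor b\rfloor$ for sign $1$ or $-1$. Split disjunction $C_i,C_j$: same coefficient vector, integer on $I$, zero off $I$, and one is $a\cdot x\le\delta$, the other $a\cdot x\ge\delta+1$ with $\delta\in\mathbb{Z}$. Validity of derived $C_k$: ($\mathtt{asm}$) $\mathtt{A}(C_k)=\{k\}$; ($\mathtt{lin}$) $\mathtt{nz}(\lambda)\subseteq[k-1]$, $\mathtt{A}(C_k)=\bigcup_{i\in\mathtt{nz}(\lambda)}\mathtt{A}(C_i)$, and the combination dominates $C_k$; ($\mathtt{rnd}$) same, with the combination roundable and its rounding dominating $C_k$; ($\mathtt{uns}$) $i_1,l_1,i_2,l_2<k$, $C_{i_1},C_{i_2}$ dominate $C_k$, $C_{l_1},C_{l_2}$ split disjunction, $\mathtt{A}(C_k)=(\mathtt{A}(C_{i_1})\setminus\{l_1\})\cup(\mathtt{A}(C_{i_2})\setminus\{l_2\})$;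 ($\mathtt{sol}$) $\mathtt{A}(C_k)=\emptyset$ and for some $sol\in SOL$, $c\cdot x\le c\cdot sol$ (min) or $c\cdot x\ge c\cdot sol$ (max) dominates $C_k$. Predicates: $A_k^j=[j\in\mathtt{A}(C_k)]$; $S_{<k},S_{>k}$ the elements of $S$ below/above $k$. $\phi_{ASM}(k)=\bigwedge_{j\in S_{>k}}\neg A_k^j\wedge\bigwedge_{j\in S_{<k}}\big(A_k^j=\bigvee_{i\in\mathtt{nz}(\lambda),j\le i<k}A_i^j\big)$. $\phi_{PRV}(k)=\bigwedge_{j\in\mathtt{nz}(\lambda)}(j<k)$. With $N=\mathtt{nz}(\lambda)$: $eq=\bigwedge_{i\in N}(\lambda_is(C_i)=0)$, $geq=\bigwedge_{i\in N}(\lambda_is(C_i)\ge0)$, $leq=\bigwedge_{i\in N}(\lambda_is(C_i)\le0)$, $A=(\sum_{i\in N}\lambda_ia_{i,j})_{j\in[n]}$, $B=\sum_{i\in N}\lambda_ib_i$. $\phi_{DOM}(a,b,eq,geq,leq,a',b',eq',geq',leq')=[\bigwedge_j(a_j=0)\wedge(\text{if }eq\text{ then }b\ne0\text{ else if }geq\text{ then }b>0\text{ else if }leq\text{ then }b<0\text{ else false})]\vee[\bigwedge_j(a_j=a'_j)\wedge(\text{if }eq'\text{ then }(eq\wedge b=b')\text{ else if }geq'\text{ then }(geq\wedge b\ge b')\text{ else if }leq'\text{ then }(leq\wedge b\le b')\text{ else false})]$.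
   Formalization: The coefficients $a_{i,j}$, right-hand sides $b_i$, objective $c$, multipliers λ and the points of $SOL$ are all rational rather than real. -}

module Defs where

open import Data.Nat as ℕ using (ℕ; zero; suc)
open import Data.Fin using (Fin; toℕ; inject≤) renaming (zero to fzero; suc to fsuc)
open import Data.Integer as ℤ using (ℤ)
open import Data.Rational as ℚ using (ℚ; 0ℚ; 1ℚ; _/_)
open import Data.Rational.Properties using (_≟_; _≤?_; _<?_)
open import Data.Bool using (Bool; true; false; _∧_; _∨_; not; if_then_else_)
open import Data.List using (List; allFin; foldr)
open import Data.List.Membership.Propositional using (_∈_)
open import Data.Product using (Σ; ∃; ∃-syntax; _×_; _,_)
open import Data.Sum using (_⊎_)
open import Relation.Binary.PropositionalEquality using (_≡_)
open import Relation.Nullary using (¬_)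
open import Relation.Nullary.Decidable using (⌊_⌋)
open import Function.Bundles using (_⇔_)

-- Basic objects.  Numbers are rationals.
-- Indices: the paper's constraint C_k (1 ≤ k ≤ d) is index k-1 : Fin d.

data Sign : Set where
  LE EQ GE : Sign

signℚ : Sign → ℚ
signℚ LE = ℚ.- 1ℚ
signℚ EQ = 0ℚ
signℚ GE = 1ℚ

record Constraint (n : ℕ) : Set where
  constructor mkC
  field
    coef : Fin n → ℚ
    rhs  : ℚ
    sign : Sign
open Constraint public

data Sense : Set where
  min max : Sense

record IP : Set where
  field
    n     : ℕ
    int   : Fin n → Bool          -- j ∈ I  iff  int j ≡ true
    obj   : Fin n → ℚ
    sense : Sense
    m     : ℕ
    cons  : Fin m → Constraint n
open IP public

all any : {A : Set} → (A → Bool) → List A → Bool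
all p = foldr (λ x r → p x ∧ r) true
any p = foldr (λ x r → p x ∨ r) false

∑ : ∀ {k} → (Fin k → ℚ) → ℚ
∑ {zero}  f = 0ℚ
∑ {suc k} f = f fzero ℚ.+ ∑ (λ i → f (fsuc i))

data Reason (d : ℕ) : Set where
  asm : Reason d
  lin : (Fin d → ℚ) → Reason d
  rnd : (Fin d → ℚ) → Reason d
  uns : (i₁ l₁ i₂ l₂ : Fin d) → Reason d
  sol : Reason d

isAsm : ∀ {d} → Reason d → Bool
isAsm asm = true
isAsm _   = false

-- a VIPR certificate for ip (RTP omitted: it plays no role here)
record Certificate (ip : IP) : Set where
  field
    d      : ℕ
    m≤d    : m ip ℕ.≤ d
    C      : Fin d → Constraint (n ip)
    C-orig : ∀ (i : Fin (m ip)) → C (inject≤ i m≤d) ≡ cons ip i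
    SOL    : List (Fin (n ip) → ℚ)
    reason : Fin d → Reason d          -- meaningful for derived constraints
    Asm    : Fin d → Fin d → Bool      -- Asm k j ≡ true  iff  j ∈ A(C_k)
    A-orig : ∀ i j → toℕ i ℕ.< m ip → Asm i j ≡ false
    A⊆S    : ∀ k j → Asm k j ≡ true →
             (m ip ℕ.≤ toℕ j) × (isAsm (reason j) ≡ true)
open Certificate public

module _ {ip : IP} (cert : Certificate ip) where

  private
    N = n ip
    D = d cert
    a : Fin D → Fin N → ℚ
    a i = coef (C cert i)
    b : Fin D → ℚ
    b i = rhs (C cert i)
    s : Fin D → Sign
    s i = sign (C cert i)

  Absurd : Constraint N → Set
  Absurd (mkC α β σ) = (∀ j → α j ≡ 0ℚ) ×
    ((σ ≡ EQ × ¬ (β ≡ 0ℚ)) ⊎ (σ ≡ GE × 0ℚ ℚ.< β) ⊎ (σ ≡ LE × β ℚ.< 0ℚ))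

  Dominates : Constraint N → Constraint N → Set
  Dominates c₁ c₂ = Absurd c₁ ⊎ ((∀ j → coef c₁ j ≡ coef c₂ j) × SignOK (sign c₂))
    where
      SignOK : Sign → Set
      SignOK EQ = sign c₁ ≡ EQ × rhs c₁ ≡ rhs c₂
      SignOK GE = (sign c₁ ≡ EQ ⊎ sign c₁ ≡ GE) × rhs c₂ ℚ.≤ rhs c₁
      SignOK LE = (sign c₁ ≡ EQ ⊎ sign c₁ ≡ LE) × rhs c₁ ℚ.≤ rhs c₂

  NZ : (Fin D → ℚ) → Fin D → Set
  NZ λ' i = ¬ (λ' i ≡ 0ℚ)

  combA : (Fin D → ℚ) → Fin N → ℚ
  combA λ' j = ∑ (λ i → λ' i ℚ.* a i j)

  combB : (Fin D → ℚ) → ℚ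
  combB λ' = ∑ (λ i → λ' i ℚ.* b i)

  -- the sign of the combination (undefined if no constructor applies)
  AllEq AllGeq AllLeq : (Fin D → ℚ) → Set
  AllEq  λ' = ∀ i → NZ λ' i → λ' i ℚ.* signℚ (s i) ≡ 0ℚ
  AllGeq λ' = ∀ i → NZ λ' i → 0ℚ ℚ.≤ λ' i ℚ.* signℚ (s i)
  AllLeq λ' = ∀ i → NZ λ' i → λ' i ℚ.* signℚ (s i) ℚ.≤ 0ℚ

  CombSign : (Fin D → ℚ) → Sign → Set
  CombSign λ' EQ = AllEq λ'
  CombSign λ' GE = ¬ AllEq λ' × AllGeq λ'
  CombSign λ' LE = ¬ AllEq λ' × ¬ AllGeq λ' × AllLeq λ'

  CombDominates : (Fin D → ℚ) → Constraint N → Set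
  CombDominates λ' c = ∃[ σ ] (CombSign λ' σ × Dominates (mkC (combA λ') (combB λ') σ) c)

  IsInt : ℚ → Set
  IsInt q = ∃[ z ] (q ≡ z / 1)

  IntVec : (Fin N → ℚ) → Set
  IntVec α = ∀ j → (int ip j ≡ true → IsInt (α j)) × (int ip j ≡ false → α j ≡ 0ℚ)

  roundRhs : Sign → ℚ → ℚ
  roundRhs GE β = ℚ.ceiling β / 1
  roundRhs LE β = ℚ.floor β / 1
  roundRhs EQ β = β

  RndDominates : (Fin D → ℚ) → Constraint N → Set
  RndDominates λ' c = ∃[ σ ] (CombSign λ' σ × (σ ≡ GE ⊎ σ ≡ LE) × IntVec (combA λ') ×
    Dominates (mkC (combA λ') (roundRhs σ (combB λ')) σ) c)

  SplitDisj : Constraint N → Constraint N → Set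
  SplitDisj c₁ c₂ = (∀ j → coef c₁ j ≡ coef c₂ j) × IntVec (coef c₁) ×
    ∃[ δ ] ((sign c₁ ≡ LE × rhs c₁ ≡ δ / 1 × sign c₂ ≡ GE × rhs c₂ ≡ (δ ℤ.+ ℤ.+ 1) / 1)
          ⊎ (sign c₂ ≡ LE × rhs c₂ ≡ δ / 1 × sign c₁ ≡ GE × rhs c₁ ≡ (δ ℤ.+ ℤ.+ 1) / 1))

  _<ᶠ_ : Fin D → Fin D → Set
  i <ᶠ k = toℕ i ℕ.< toℕ k

  objC : Fin (n ip) → ℚ
  objC = obj ip

  dot : (Fin N → ℚ) → (Fin N → ℚ) → ℚ
  dot u v = ∑ (λ j → u j ℚ.* v j)

  solConstraint : (Fin N → ℚ) → Constraint N
  solConstraint x with sense ip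
  ... | min = mkC objC (dot objC x) LE
  ... | max = mkC objC (dot objC x) GE

  ValidR : (k : Fin D) → Reason D → Set
  ValidR k asm = ∀ j → Asm cert k j ≡ true ⇔ j ≡ k
  ValidR k (lin λ') = (∀ i → NZ λ' i → i <ᶠ k) ×
    (∀ j → Asm cert k j ≡ true ⇔ (∃[ i ] (NZ λ' i × Asm cert i j ≡ true))) ×
    CombDominates λ' (C cert k)
  ValidR k (rnd λ') = (∀ i → NZ λ' i → i <ᶠ k) ×
    (∀ j → Asm cert k j ≡ true ⇔ (∃[ i ] (NZ λ' i × Asm cert i j ≡ true))) ×
    RndDominates λ' (C cert k)
  ValidR k (uns i₁ l₁ i₂ l₂) = (i₁ <ᶠ k × l₁ <ᶠ k × i₂ <ᶠ k × l₂ <ᶠ k) ×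
    Dominates (C cert i₁) (C cert k) × Dominates (C cert i₂) (C cert k) ×
    SplitDisj (C cert l₁) (C cert l₂) ×
    (∀ j → Asm cert k j ≡ true ⇔
      ((Asm cert i₁ j ≡ true × ¬ (j ≡ l₁)) ⊎ (Asm cert i₂ j ≡ true × ¬ (j ≡ l₂))))
  ValidR k sol = (∀ j → Asm cert k j ≡ false) ×
    ∃[ x ] (x ∈ SOL cert × Dominates (solConstraint x) (C cert k))

  Valid : Fin D → Set
  Valid k = ValidR k (reason cert k)

  finsD : List (Fin D)
  finsD = allFin D

  nzᵇ : (Fin D → ℚ) → Fin D → Bool
  nzᵇ λ' i = not ⌊ λ' i ≟ 0ℚ ⌋

  ltᵇ : Fin D → Fin D → Bool
  ltᵇ i k = ⌊ toℕ i ℕ.<? toℕ k ⌋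

  leᵇ : Fin D → Fin D → Bool
  leᵇ i k = ⌊ toℕ i ℕ.≤? toℕ k ⌋

  inSᵇ : Fin D → Bool
  inSᵇ j = ⌊ m ip ℕ.≤? toℕ j ⌋ ∧ isAsm (reason cert j)

  _==ᵇ_ : Bool → Bool → Bool
  true  ==ᵇ y = y
  false ==ᵇ y = not y

  eqℚᵇ : ℚ → ℚ → Bool
  eqℚᵇ p q = ⌊ p ≟ q ⌋

  φASM : Fin D → (Fin D → ℚ) → Bool
  φASM k λ' = all (λ j → not (inSᵇ j ∧ ltᵇ k j) || not (Asm cert k j)) finsD
            ∧ all (λ j → not (inSᵇ j ∧ ltᵇ j k) ||
                 (Asm cert k j ==ᵇ any (λ i → nzᵇ λ' i ∧ leᵇ j i ∧ ltᵇ i k ∧ Asm cert i j) finsD)) finsD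
    where
      _||_ : Bool → Bool → Bool
      true  || _ = true
      false || y = y

  φPRV : Fin D → (Fin D → ℚ) → Bool
  φPRV k λ' = all (λ j → not (nzᵇ λ' j) ∨ ltᵇ j k) finsD

  eqᵇ geqᵇ leqᵇ : (Fin D → ℚ) → Bool
  eqᵇ  λ' = all (λ i → not (nzᵇ λ' i) ∨ eqℚᵇ (λ' i ℚ.* signℚ (s i)) 0ℚ) finsD
  geqᵇ λ' = all (λ i → not (nzᵇ λ' i) ∨ ⌊ 0ℚ ≤? λ' i ℚ.* signℚ (s i) ⌋) finsD
  leqᵇ λ' = all (λ i → not (nzᵇ λ' i) ∨ ⌊ λ' i ℚ.* signℚ (s i) ≤? 0ℚ ⌋) finsD

  allFinN : (Fin N → Bool) → Bool
  allFinN p = all p (allFin N)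

  φDOM : (Fin N → ℚ) → ℚ → Bool → Bool → Bool → (Fin N → ℚ) → ℚ → Bool → Bool → Bool → Bool
  φDOM α β e g l α' β' e' g' l' =
      (allFinN (λ j → eqℚᵇ (α j) 0ℚ) ∧
        (if e then not (eqℚᵇ β 0ℚ) else if g then ⌊ 0ℚ <? β ⌋ else if l then ⌊ β <? 0ℚ ⌋ else false))
    ∨ (allFinN (λ j → eqℚᵇ (α j) (α' j)) ∧
        (if e' then (e ∧ eqℚᵇ β β') else if g' then (g ∧ ⌊ β' ≤? β ⌋)
         else if l' then (l ∧ ⌊ β ≤? β' ⌋) else false))

  sEqᵇ sGeqᵇ sLeqᵇ : Sign → Bool
  sEqᵇ EQ = true
  sEqᵇ _  = false
  sGeqᵇ LE = false
  sGeqᵇ _  = true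
  sLeqᵇ GE = false
  sLeqᵇ _  = true

  φDER : Fin D → (Fin D → ℚ) → Bool
  φDER k λ' = φASM k λ' ∧ φPRV k λ' ∧
    φDOM (combA λ') (combB λ') (eqᵇ λ') (geqᵇ λ') (leqᵇ λ')
         (a k) (b k) (sEqᵇ (s k)) (sGeqᵇ (s k)) (sLeqᵇ (s k))

{-# OPTIONS --safe #-}
module Submission where

-- Each conjunct of φDER decides one clause of validity for lin.  φPRV and φDOM
-- reflect their clauses outright: the flags eq, geq, leq of a combination
-- determine its sign (if any), and φDOM evaluated on the flags of two signs
-- decides domination.  φASM matches the assumption clause only in context:
-- as the earlier constraints are valid, every assumption of C_i precedes i
-- (well-founded induction along the certificate).  So for i ∈ nz(λ) ⊆ [k-1]
-- the extra test j ≤ i < k of φASM is automatic, no assumption after k can be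
-- inherited, and k itself is no assumption since C_k is derived by lin.

open import Defs
open import Level using (Level)
open import Data.Nat using (_≤_; _≤?_; _<?_)
open import Data.Nat.Properties using (<-cmp; ≤-reflexive; <⇒≤; ≤-<-trans; <-trans; <-asym; ≰⇒>)
open import Data.Fin using (Fin; toℕ)
open import Data.Fin.Properties using (toℕ-injective; ¬∀⟶∃¬)
open import Data.Fin.Induction using (<-wellFounded)
open import Induction.WellFounded using (Acc; acc)
open import Data.Rational using (ℚ; 0ℚ; _<_; _*_)
import Data.Rational.Properties as ℚ
open import Data.Bool using (Bool; true; false; T; _∧_; _∨_; not; if_then_else_)
open import Data.Bool.Properties using (T-∧; T-≡; ∧-zeroʳ)
open import Data.Unit using (tt)
open import Data.Empty using (⊥)
open import Data.Product using (∃-syntax; _×_; _,_; proj₁; proj₂; uncurry)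
open import Data.Sum using (_⊎_; inj₁; inj₂; [_,_]′)
open import Data.List using ([]; _∷_; allFin)
open import Data.List.Relation.Unary.All as All using (All; []; _∷_)
open import Data.List.Relation.Unary.Any as Any using (Any)
open import Data.List.Membership.Propositional using (lose)
open import Data.List.Membership.Propositional.Properties using (∈-allFin)
open import Relation.Nullary using (¬_; Dec; yes; no; contradiction)
open import Relation.Nullary.Decidable using (⌊_⌋; T?; decidable-stable)
open import Relation.Nullary.Reflects
  using (Reflects; ofʸ; ofⁿ; T-reflects; ¬-reflects; _×-reflects_; _⊎-reflects_; _→-reflects_)
open import Relation.Binary.PropositionalEquality using (_≡_; refl; sym; trans; subst; cong; cong₂)
open import Relation.Binary.Definitions using (tri<; tri≈; tri>)
open import Function.Base using (flip)
open import Function.Bundles using (_⇔_; mk⇔; Equivalence)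
import Function.Properties.Equivalence as ⇔

open Equivalence using (to; from)

private
  variable
    a ℓ : Level
    A B : Set a
    b : Bool

Reflects-map : (A → B) → (B → A) → Reflects A b → Reflects B b
Reflects-map f g (ofʸ x)  = ofʸ (f x)
Reflects-map f g (ofⁿ ¬x) = ofⁿ (λ y → ¬x (g y))

Reflects⇒T⇔ : Reflects A b → T b ⇔ A
Reflects⇒T⇔ (ofʸ x)  = mk⇔ (λ _ → x) (λ _ → tt)
Reflects⇒T⇔ (ofⁿ ¬x) = mk⇔ (λ ()) ¬x

⌊⌋-reflects : (a? : Dec A) → Reflects A ⌊ a? ⌋
⌊⌋-reflects (yes x) = ofʸ x
⌊⌋-reflects (no ¬x) = ofⁿ ¬x

≡true-reflects : ∀ b → Reflects (b ≡ true) b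
≡true-reflects true  = ofʸ refl
≡true-reflects false = ofⁿ λ ()

¬T-∧ : ∀ {x y} → ¬ T (x ∧ y) → ¬ T x ⊎ ¬ T y
¬T-∧ {true}  ¬y = inj₂ ¬y
¬T-∧ {false} _  = inj₁ λ ()

module _ {X : Set} {P : X → Set ℓ} {p : X → Bool} (P-reflects : ∀ x → Reflects (P x) (p x)) where

  all-reflects : ∀ xs → Reflects (All P xs) (all p xs)
  all-reflects []       = ofʸ []
  all-reflects (x ∷ xs) =
    Reflects-map (uncurry _∷_) All.uncons (P-reflects x ×-reflects all-reflects xs)

  any-reflects : ∀ xs → Reflects (Any P xs) (any p xs)
  any-reflects []       = ofⁿ λ ()
  any-reflects (x ∷ xs) =
    Reflects-map Any.fromSum Any.toSum (P-reflects x ⊎-reflects any-reflects xs)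

module _ {n} {P : Fin n → Set ℓ} {p : Fin n → Bool} (P-reflects : ∀ i → Reflects (P i) (p i)) where

  ∀-reflects : Reflects (∀ i → P i) (all p (allFin n))
  ∀-reflects = Reflects-map (λ ps i → All.lookup ps (∈-allFin i))
                            (λ ps → All.tabulate λ {i} _ → ps i)
                            (all-reflects P-reflects (allFin n))

  ∃-reflects : Reflects (∃[ i ] P i) (any p (allFin n))
  ∃-reflects = Reflects-map Any.satisfied (λ (i , pi) → lose (∈-allFin i) pi)
                            (any-reflects P-reflects (allFin n))

module _ {n} {p : Fin n → Bool} where

  T-all : T (all p (allFin n)) → ∀ i → T (p i)
  T-all = to (Reflects⇒T⇔ (∀-reflects λ i → T-reflects (p i)))

  ¬T-all : ¬ T (all p (allFin n)) → ∃[ i ] ¬ T (p i)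
  ¬T-all ¬all = ¬∀⟶∃¬ n _ (λ i → T? (p i))
    λ all-p → ¬all (from (Reflects⇒T⇔ (∀-reflects λ i → T-reflects (p i))) all-p)

module _ {ip : IP} (cert : Certificate ip) where

  private
    D = d cert

  sEqᵇ-reflects : ∀ σ → Reflects (σ ≡ EQ) (sEqᵇ cert σ)
  sEqᵇ-reflects LE = ofⁿ λ ()
  sEqᵇ-reflects EQ = ofʸ refl
  sEqᵇ-reflects GE = ofⁿ λ ()

  sGeqᵇ-reflects : ∀ σ → Reflects (σ ≡ EQ ⊎ σ ≡ GE) (sGeqᵇ cert σ)
  sGeqᵇ-reflects LE = ofⁿ [ (λ ()) , (λ ()) ]′
  sGeqᵇ-reflects EQ = ofʸ (inj₁ refl)
  sGeqᵇ-reflects GE = ofʸ (inj₂ refl)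

  sLeqᵇ-reflects : ∀ σ → Reflects (σ ≡ EQ ⊎ σ ≡ LE) (sLeqᵇ cert σ)
  sLeqᵇ-reflects LE = ofʸ (inj₂ refl)
  sLeqᵇ-reflects EQ = ofʸ (inj₁ refl)
  sLeqᵇ-reflects GE = ofⁿ [ (λ ()) , (λ ()) ]′

  ==ᵇ-reflects : ∀ {x y} → Reflects A x → Reflects B y → Reflects (A ⇔ B) (_==ᵇ_ cert x y)
  ==ᵇ-reflects (ofʸ a)  (ofʸ b)  = ofʸ (mk⇔ (λ _ → b) (λ _ → a))
  ==ᵇ-reflects (ofʸ a)  (ofⁿ ¬b) = ofⁿ λ a⇔b → ¬b (to a⇔b a)
  ==ᵇ-reflects (ofⁿ ¬a) (ofʸ b)  = ofⁿ λ a⇔b → ¬a (from a⇔b b)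
  ==ᵇ-reflects (ofⁿ ¬a) (ofⁿ ¬b) = ofʸ (mk⇔ (flip contradiction ¬a) (flip contradiction ¬b))

  absurdRhs-reflects : ∀ σ β →
    Reflects ((σ ≡ EQ × ¬ β ≡ 0ℚ) ⊎ (σ ≡ GE × 0ℚ < β) ⊎ (σ ≡ LE × β < 0ℚ))
      (if sEqᵇ cert σ then not (eqℚᵇ cert β 0ℚ) else if sGeqᵇ cert σ then ⌊ 0ℚ ℚ.<? β ⌋
       else if sLeqᵇ cert σ then ⌊ β ℚ.<? 0ℚ ⌋ else false)
  absurdRhs-reflects LE β = Reflects-map (λ β<0 → inj₂ (inj₂ (refl , β<0)))
    (λ { (inj₁ (() , _)) ; (inj₂ (inj₁ (() , _))) ; (inj₂ (inj₂ (_ , β<0))) → β<0 })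
    (⌊⌋-reflects (β ℚ.<? 0ℚ))
  absurdRhs-reflects EQ β = Reflects-map (λ β≢0 → inj₁ (refl , β≢0))
    (λ { (inj₁ (_ , β≢0)) → β≢0 ; (inj₂ (inj₁ (() , _))) ; (inj₂ (inj₂ (() , _))) })
    (¬-reflects (⌊⌋-reflects (β ℚ.≟ 0ℚ)))
  absurdRhs-reflects GE β = Reflects-map (λ 0<β → inj₂ (inj₁ (refl , 0<β)))
    (λ { (inj₁ (() , _)) ; (inj₂ (inj₁ (_ , 0<β))) → 0<β ; (inj₂ (inj₂ (() , _))) })
    (⌊⌋-reflects (0ℚ ℚ.<? β))

  dominates-reflects : ∀ α β σ α′ β′ σ′ →
    Reflects (Dominates cert (mkC α β σ) (mkC α′ β′ σ′))
      (φDOM cert α β (sEqᵇ cert σ) (sGeqᵇ cert σ) (sLeqᵇ cert σ)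
                 α′ β′ (sEqᵇ cert σ′) (sGeqᵇ cert σ′) (sLeqᵇ cert σ′))
  dominates-reflects α β σ α′ β′ LE =
    (∀-reflects (λ j → ⌊⌋-reflects (α j ℚ.≟ 0ℚ)) ×-reflects absurdRhs-reflects σ β)
    ⊎-reflects ∀-reflects (λ j → ⌊⌋-reflects (α j ℚ.≟ α′ j))
               ×-reflects sLeqᵇ-reflects σ ×-reflects ⌊⌋-reflects (β ℚ.≤? β′)
  dominates-reflects α β σ α′ β′ EQ =
    (∀-reflects (λ j → ⌊⌋-reflects (α j ℚ.≟ 0ℚ)) ×-reflects absurdRhs-reflects σ β)
    ⊎-reflects ∀-reflects (λ j → ⌊⌋-reflects (α j ℚ.≟ α′ j))
               ×-reflects sEqᵇ-reflects σ ×-reflects ⌊⌋-reflects (β ℚ.≟ β′)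
  dominates-reflects α β σ α′ β′ GE =
    (∀-reflects (λ j → ⌊⌋-reflects (α j ℚ.≟ 0ℚ)) ×-reflects absurdRhs-reflects σ β)
    ⊎-reflects ∀-reflects (λ j → ⌊⌋-reflects (α j ℚ.≟ α′ j))
               ×-reflects sGeqᵇ-reflects σ ×-reflects ⌊⌋-reflects (β′ ℚ.≤? β)

  φDOM-unsigned : ∀ α β α′ β′ σ′ →
    φDOM cert α β false false false α′ β′ (sEqᵇ cert σ′) (sGeqᵇ cert σ′) (sLeqᵇ cert σ′) ≡ false
  φDOM-unsigned α β α′ β′ LE = cong₂ _∨_ (∧-zeroʳ (allFinN cert _)) (∧-zeroʳ (allFinN cert _))
  φDOM-unsigned α β α′ β′ EQ = cong₂ _∨_ (∧-zeroʳ (allFinN cert _)) (∧-zeroʳ (allFinN cert _))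
  φDOM-unsigned α β α′ β′ GE = cong₂ _∨_ (∧-zeroʳ (allFinN cert _)) (∧-zeroʳ (allFinN cert _))

  module _ (λ′ : Fin D → ℚ) where

    private
      weightedSign : Fin D → ℚ
      weightedSign i = λ′ i * signℚ (sign (C cert i))

    nz-reflects : ∀ i → Reflects (NZ cert λ′ i) (nzᵇ cert λ′ i)
    nz-reflects i = ¬-reflects (⌊⌋-reflects (λ′ i ℚ.≟ 0ℚ))

    allEq-reflects : Reflects (AllEq cert λ′) (eqᵇ cert λ′)
    allEq-reflects = ∀-reflects λ i → nz-reflects i →-reflects ⌊⌋-reflects (weightedSign i ℚ.≟ 0ℚ)

    allGeq-reflects : Reflects (AllGeq cert λ′) (geqᵇ cert λ′)
    allGeq-reflects = ∀-reflects λ i → nz-reflects i →-reflects ⌊⌋-reflects (0ℚ ℚ.≤? weightedSign i)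

    allLeq-reflects : Reflects (AllLeq cert λ′) (leqᵇ cert λ′)
    allLeq-reflects = ∀-reflects λ i → nz-reflects i →-reflects ⌊⌋-reflects (weightedSign i ℚ.≤? 0ℚ)

    allEq⇒allGeq : AllEq cert λ′ → AllGeq cert λ′
    allEq⇒allGeq eq i nz = ℚ.≤-reflexive (sym (eq i nz))

    allEq⇒allLeq : AllEq cert λ′ → AllLeq cert λ′
    allEq⇒allLeq eq i nz = ℚ.≤-reflexive (eq i nz)

    allGeq∧allLeq⇒allEq : AllGeq cert λ′ → AllLeq cert λ′ → AllEq cert λ′
    allGeq∧allLeq⇒allEq geq leq i nz = ℚ.≤-antisym (leq i nz) (geq i nz)

    combSign-unique : ∀ {σ τ} → CombSign cert λ′ σ → CombSign cert λ′ τ → σ ≡ τ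
    combSign-unique {LE} {LE} _            _            = refl
    combSign-unique {LE} {EQ} (¬eq , _)    eq           = contradiction eq ¬eq
    combSign-unique {LE} {GE} (_ , ¬geq , _) (_ , geq)  = contradiction geq ¬geq
    combSign-unique {EQ} {LE} eq           (¬eq , _)    = contradiction eq ¬eq
    combSign-unique {EQ} {EQ} _            _            = refl
    combSign-unique {EQ} {GE} eq           (¬eq , _)    = contradiction eq ¬eq
    combSign-unique {GE} {LE} (_ , geq)    (_ , ¬geq , _) = contradiction geq ¬geq
    combSign-unique {GE} {EQ} (¬eq , _)    eq           = contradiction eq ¬eq
    combSign-unique {GE} {GE} _            _            = refl

    data SignFlags : Bool → Bool → Bool → Set where
      signed   : ∀ σ → CombSign cert λ′ σ → SignFlags (sEqᵇ cert σ) (sGeqᵇ cert σ) (sLeqᵇ cert σ)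
      unsigned : (∀ σ → ¬ CombSign cert λ′ σ) → SignFlags false false false

    signFlags : SignFlags (eqᵇ cert λ′) (geqᵇ cert λ′) (leqᵇ cert λ′)
    signFlags with eqᵇ cert λ′  | allEq-reflects
                 | geqᵇ cert λ′ | allGeq-reflects
                 | leqᵇ cert λ′ | allLeq-reflects
    ... | _ | ofʸ eq  | _ | ofʸ _    | _ | ofʸ _    = signed EQ eq
    ... | _ | ofʸ eq  | _ | ofⁿ ¬geq | _ | _        = contradiction (allEq⇒allGeq eq) ¬geq
    ... | _ | ofʸ eq  | _ | ofʸ _    | _ | ofⁿ ¬leq = contradiction (allEq⇒allLeq eq) ¬leq
    ... | _ | ofⁿ ¬eq | _ | ofʸ geq  | _ | ofʸ leq  = contradiction (allGeq∧allLeq⇒allEq geq leq) ¬eq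
    ... | _ | ofⁿ ¬eq | _ | ofʸ geq  | _ | ofⁿ _    = signed GE (¬eq , geq)
    ... | _ | ofⁿ ¬eq | _ | ofⁿ ¬geq | _ | ofʸ leq  = signed LE (¬eq , ¬geq , leq)
    ... | _ | ofⁿ ¬eq | _ | ofⁿ ¬geq | _ | ofⁿ ¬leq = unsigned λ where
      LE (_ , _ , leq) → ¬leq leq
      EQ eq            → ¬eq eq
      GE (_ , geq)     → ¬geq geq

    combDominates-reflects : ∀ c →
      Reflects (CombDominates cert λ′ c)
        (φDOM cert (combA cert λ′) (combB cert λ′) (eqᵇ cert λ′) (geqᵇ cert λ′) (leqᵇ cert λ′)
                   (coef c) (rhs c) (sEqᵇ cert (sign c)) (sGeqᵇ cert (sign c)) (sLeqᵇ cert (sign c)))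
    combDominates-reflects c with eqᵇ cert λ′ | geqᵇ cert λ′ | leqᵇ cert λ′ | signFlags
    ... | _ | _ | _ | signed σ σ-sign =
      Reflects-map (λ dom → σ , σ-sign , dom)
                   (λ (τ , τ-sign , dom) →
                      subst (λ ρ → Dominates cert (mkC (combA cert λ′) (combB cert λ′) ρ) c)
                            (combSign-unique τ-sign σ-sign) dom)
                   (dominates-reflects (combA cert λ′) (combB cert λ′) σ (coef c) (rhs c) (sign c))
    ... | _ | _ | _ | unsigned no-sign =
      subst (Reflects _) (sym (φDOM-unsigned (combA cert λ′) (combB cert λ′) (coef c) (rhs c) (sign c)))
            (ofⁿ λ (σ , σ-sign , _) → no-sign σ σ-sign)

  lt-reflects : ∀ i j → Reflects (_<ᶠ_ cert i j) (ltᵇ cert i j)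
  lt-reflects i j = ⌊⌋-reflects (toℕ i <? toℕ j)

  le-reflects : ∀ i j → Reflects (toℕ i ≤ toℕ j) (leᵇ cert i j)
  le-reflects i j = ⌊⌋-reflects (toℕ i ≤? toℕ j)

  SupportBefore : Fin D → (Fin D → ℚ) → Set
  SupportBefore k λ′ = ∀ i → NZ cert λ′ i → _<ᶠ_ cert i k

  φPRV-reflects : ∀ k λ′ → Reflects (SupportBefore k λ′) (φPRV cert k λ′)
  φPRV-reflects k λ′ = ∀-reflects λ i → nz-reflects λ′ i →-reflects lt-reflects i k

  Assumption : Fin D → Set
  Assumption j = m ip ≤ toℕ j × isAsm (reason cert j) ≡ true

  assumption-reflects : ∀ j → Reflects (Assumption j) (inSᵇ cert j)
  assumption-reflects j = ⌊⌋-reflects (m ip ≤? toℕ j) ×-reflects ≡true-reflects (isAsm (reason cert j))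

  AssumptionsPrecede : Fin D → Set
  AssumptionsPrecede i = ∀ j → Asm cert i j ≡ true → toℕ j ≤ toℕ i

  validR⇒assumptionsPrecede : ∀ {i} r → ValidR cert i r →
    (∀ i′ → _<ᶠ_ cert i′ i → AssumptionsPrecede i′) → AssumptionsPrecede i
  validR⇒assumptionsPrecede asm asm-ok _ j h = ≤-reflexive (cong toℕ (to (asm-ok j) h))
  validR⇒assumptionsPrecede (lin μ) (prv , asm-ok , _) ih j h with to (asm-ok j) h
  ... | i′ , nz , h′ = <⇒≤ (≤-<-trans (ih i′ (prv i′ nz) j h′) (prv i′ nz))
  validR⇒assumptionsPrecede (rnd μ) (prv , asm-ok , _) ih j h with to (asm-ok j) h
  ... | i′ , nz , h′ = <⇒≤ (≤-<-trans (ih i′ (prv i′ nz) j h′) (prv i′ nz))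
  validR⇒assumptionsPrecede (uns i₁ l₁ i₂ l₂) ((i₁<i , _ , i₂<i , _) , _ , _ , _ , asm-ok) ih j h
    with to (asm-ok j) h
  ... | inj₁ (h′ , _) = <⇒≤ (≤-<-trans (ih i₁ i₁<i j h′) i₁<i)
  ... | inj₂ (h′ , _) = <⇒≤ (≤-<-trans (ih i₂ i₂<i j h′) i₂<i)
  validR⇒assumptionsPrecede sol (no-asm , _) _ j h = contradiction (trans (sym (no-asm j)) h) λ ()

  assumptionsPrecede : ∀ k → (∀ i → m ip ≤ toℕ i → _<ᶠ_ cert i k → Valid cert i) →
    ∀ i → _<ᶠ_ cert i k → AssumptionsPrecede i
  assumptionsPrecede k valid i = go i (<-wellFounded i)
    where
      go : ∀ i → Acc (_<ᶠ_ cert) i → _<ᶠ_ cert i k → AssumptionsPrecede i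
      go i (acc smaller) i<k with m ip ≤? toℕ i
      ... | no i≱m  = λ j h → contradiction (trans (sym (A-orig cert i j (≰⇒> i≱m))) h) λ ()
      ... | yes m≤i = validR⇒assumptionsPrecede (reason cert i) (valid i m≤i i<k)
                        λ i′ i′<i → go i′ (smaller i′<i) (<-trans i′<i i<k)

  Inherited : (Fin D → ℚ) → Fin D → Set
  Inherited λ′ j = ∃[ i ] (NZ cert λ′ i × Asm cert i j ≡ true)

  InheritsAssumptions : Fin D → (Fin D → ℚ) → Set
  InheritsAssumptions k λ′ = ∀ j → Asm cert k j ≡ true ⇔ Inherited λ′ j

  module _ {k : Fin D} {λ′ : Fin D → ℚ}
           (reason≡lin : reason cert k ≡ lin λ′)
           (precede : ∀ i → _<ᶠ_ cert i k → AssumptionsPrecede i)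
           (prv : SupportBefore k λ′) where

    inherited-reflects : ∀ j →
      Reflects (Inherited λ′ j)
               (any (λ i → nzᵇ cert λ′ i ∧ leᵇ cert j i ∧ ltᵇ cert i k ∧ Asm cert i j) (finsD cert))
    inherited-reflects j =
      Reflects-map (λ (i , nz , _ , _ , h) → i , nz , h)
                   (λ (i , nz , h) → i , nz , precede i (prv i nz) j h , prv i nz , h)
        (∃-reflects λ i → nz-reflects λ′ i ×-reflects le-reflects j i ×-reflects lt-reflects i k
                           ×-reflects ≡true-reflects (Asm cert i j))

    inherited⇒< : ∀ {j} → Inherited λ′ j → _<ᶠ_ cert j k
    inherited⇒< {j} (i , nz , h) = ≤-<-trans (precede i (prv i nz) j h) (prv i nz)

    k-not-assumption : ¬ Assumption k
    k-not-assumption (_ , k-asm) = contradiction (trans (sym (cong isAsm reason≡lin)) k-asm) λ ()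

    not-asm⇔ : ∀ j → T (not (Asm cert k j)) ⇔ (¬ Asm cert k j ≡ true)
    not-asm⇔ j = Reflects⇒T⇔ (¬-reflects (≡true-reflects (Asm cert k j)))

    -- φASM guards its tests with an operator local to its definition, so a test is reached only by
    -- with-abstracting its guard; the explicit first conjunct given to T-∧ and ¬T-∧
    -- keeps that guard unnormalised.
    φASM⇒later : T (φASM cert k λ′) →
      ∀ j → Assumption j → _<ᶠ_ cert k j → ¬ Asm cert k j ≡ true
    φASM⇒later φ j j-asm k<j
      with inSᵇ cert j ∧ ltᵇ cert k j | assumption-reflects j ×-reflects lt-reflects k j
         | T-all (proj₁ (to (T-∧ {all _ (finsD cert)}) φ)) j
    ... | true  | _             | not-asm = to (not-asm⇔ j) not-asm
    ... | false | ofⁿ not-guard | _       = contradiction (j-asm , k<j) not-guard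

    φASM⇒earlier : T (φASM cert k λ′) →
      ∀ j → Assumption j → _<ᶠ_ cert j k → Asm cert k j ≡ true ⇔ Inherited λ′ j
    φASM⇒earlier φ j j-asm j<k
      with inSᵇ cert j ∧ ltᵇ cert j k | assumption-reflects j ×-reflects lt-reflects j k
         | T-all (proj₂ (to (T-∧ {all _ (finsD cert)}) φ)) j
    ... | true  | _             | same = to (Reflects⇒T⇔ (==ᵇ-reflects (≡true-reflects _) (inherited-reflects j))) same
    ... | false | ofⁿ not-guard | _    = contradiction (j-asm , j<k) not-guard

    φASM⇒inherits : T (φASM cert k λ′) → InheritsAssumptions k λ′
    φASM⇒inherits φ j = mk⇔ sound complete
      where
        sound : Asm cert k j ≡ true → Inherited λ′ j
        sound h with A⊆S cert k j h | <-cmp (toℕ j) (toℕ k)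
        ... | j-asm | tri< j<k _ _ = to (φASM⇒earlier φ j j-asm j<k) h
        ... | j-asm | tri≈ _ j≡k _ = contradiction (subst Assumption (toℕ-injective j≡k) j-asm) k-not-assumption
        ... | j-asm | tri> _ _ k<j = contradiction h (φASM⇒later φ j j-asm k<j)
        complete : Inherited λ′ j → Asm cert k j ≡ true
        complete inh@(i , _ , h) = from (φASM⇒earlier φ j (A⊆S cert i j h) (inherited⇒< inh)) inh

    inherits⇒φASM : InheritsAssumptions k λ′ → T (φASM cert k λ′)
    inherits⇒φASM inherits = decidable-stable (T? _) refute
      where
        refute : ¬ T (φASM cert k λ′) → ⊥
        refute ¬φ with ¬T-∧ {all _ (finsD cert)} ¬φ
        ... | inj₁ ¬later with ¬T-all ¬later
        ...   | j , ¬later-j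
                with inSᵇ cert j ∧ ltᵇ cert k j | assumption-reflects j ×-reflects lt-reflects k j | ¬later-j
        ...     | true  | ofʸ (_ , k<j) | ¬not-asm =
                    ¬not-asm (from (not-asm⇔ j) λ h → <-asym k<j (inherited⇒< (to (inherits j) h)))
        ...     | false | _             | ¬true = ¬true tt
        refute ¬φ | inj₂ ¬earlier with ¬T-all ¬earlier
        ...   | j , ¬earlier-j
                with inSᵇ cert j ∧ ltᵇ cert j k | assumption-reflects j ×-reflects lt-reflects j k | ¬earlier-j
        ...     | true  | _ | ¬same =
                    ¬same (from (Reflects⇒T⇔ (==ᵇ-reflects (≡true-reflects _) (inherited-reflects j))) (inherits j))
        ...     | false | _ | ¬true = ¬true tt

    φASM⇔inherits : T (φASM cert k λ′) ⇔ InheritsAssumptions k λ′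
    φASM⇔inherits = mk⇔ φASM⇒inherits inherits⇒φASM

  lin-valid⇔φDER : ∀ {k λ′} → reason cert k ≡ lin λ′ →
    (∀ i → m ip ≤ toℕ i → _<ᶠ_ cert i k → Valid cert i) →
    ValidR cert k (lin λ′) ⇔ T (φDER cert k λ′)
  lin-valid⇔φDER {k} {λ′} reason≡lin valid = mk⇔
    (λ (prv , inherits , dom) →
      from (T-∧ {φASM cert k λ′}) (from (φASM⇔ prv) inherits ,
        from (T-∧ {φPRV cert k λ′}) (from φPRV⇔ prv , from φDOM⇔ dom)))
    (λ φ → let φasm , φprv∧dom = to (T-∧ {φASM cert k λ′}) φ
               φprv , φdom     = to (T-∧ {φPRV cert k λ′}) φprv∧dom
               prv             = to φPRV⇔ φprv
           in prv , to (φASM⇔ prv) φasm , to φDOM⇔ φdom)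
    where
      φPRV⇔ : T (φPRV cert k λ′) ⇔ SupportBefore k λ′
      φPRV⇔ = Reflects⇒T⇔ (φPRV-reflects k λ′)
      φASM⇔ : SupportBefore k λ′ → T (φASM cert k λ′) ⇔ InheritsAssumptions k λ′
      φASM⇔ = φASM⇔inherits reason≡lin (assumptionsPrecede k valid)
      φDOM⇔ : T (φDOM cert (combA cert λ′) (combB cert λ′) (eqᵇ cert λ′) (geqᵇ cert λ′) (leqᵇ cert λ′)
                          (coef (C cert k)) (rhs (C cert k)) (sEqᵇ cert (sign (C cert k)))
                          (sGeqᵇ cert (sign (C cert k))) (sLeqᵇ cert (sign (C cert k))))
              ⇔ CombDominates cert λ′ (C cert k)
      φDOM⇔ = Reflects⇒T⇔ (combDominates-reflects λ′ (C cert k))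

lemma7 : (ip : IP) (cert : Certificate ip) (k : Fin (d cert)) (λ' : Fin (d cert) → ℚ) →
         m ip ≤ toℕ k →
         reason cert k ≡ lin λ' →
         (∀ (i : Fin (d cert)) → m ip ≤ toℕ i → _<ᶠ_ cert i k → Valid cert i) →
         (Valid cert k ⇔ (φDER cert k λ' ≡ true))
lemma7 ip cert k λ' _ reason≡lin valid =
  subst (λ r → ValidR cert k r ⇔ (φDER cert k λ' ≡ true)) (sym reason≡lin)
        (⇔.trans (lin-valid⇔φDER cert reason≡lin valid) T-≡)
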